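{- For $r\ge0$ and $\boldsymbol l=(l_1,\dots,l_r),\boldsymbol k=(k_1,\dots,k_r)\in\mathbb Z_{\ge1}^r$, \begin{align*} \zeta_{q}^{\mathrm{SZ}}(\{0\}^{l_{1}-1},k_{1},\dots,\{0\}^{l_{r}-1},k_{r}) & =\sum_{\boldsymbol{l}',\boldsymbol{k}'\in\mathbb{Z}_{\ge1}^{r}}\bar{b}(\boldsymbol{l};\boldsymbol{l}')\bar{b}(\boldsymbol{k};\boldsymbol{k}')\zeta_{q}^{\dagger}(\{\bar{1}\}^{l_{1}'-1},k_{1}',\dots,\{\bar{1}\}^{l_{r}'-1},k_{r}'),\\ \zeta_{q}^{\mathrm{SZ}}(\boldsymbol{k}) & =\sum_{\boldsymbol{k}'\in\mathbb{Z}_{\ge1}^{r}}\bar{b}(\boldsymbol{k};\boldsymbol{k}')\zeta_{q}^{\dagger}(\boldsymbol{k}'),\\ \zeta_{q}^{\dagger}(\{\bar{1}\}^{l_{1}-1},k_{1},\dots,\{\bar{1}\}^{l_{r}-1},k_{r}) & =\sum_{\boldsymbol{l}',\boldsymbol{k}'\in\mathbb{Z}_{\ge1}^{r}}b(\boldsymbol{l};\boldsymbol{l}')b(\boldsymbol{k};\boldsymbol{k}')\zeta_{q}^{\mathrm{SZ}}(\{0\}^{l_{1}'-1},k_{1}',\dots,\{0\}^{l_{r}'-1},k_{r}'),\\ \zeta_{q}^{\dagger}(\boldsymbol{k}) & =\sum_{\boldsymbol{k}'\in\mathbb{Z}_{\ge1}^{r}}b(\boldsymbol{k};\boldsymbol{k}')\zeta_{q}^{\mathrm{SZ}}(\boldsymbol{k}'),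 \end{align*} where $b(\boldsymbol m;\boldsymbol m')=\prod_{j=1}^r\binom{m_j-1}{m_j'-1}$ and $\bar b(\boldsymbol m;\boldsymbol m')=\prod_{j=1}^r(-1)^{m_j-m_j'}\binom{m_j-1}{m_j'-1}$ (so all sums are finite).
   Context: Here $\{a\}^m$ denotes $m$ repetitions of $a$. For $(k_1,\dots,k_r)\in\mathbb Z_{\ge0}^r$ with $r=0$ or $k_r>0$, the Schlesinger–Zudilin values are $\zeta_q^{\mathrm{SZ}}(\emptyset)=1$ and $\zeta_q^{\mathrm{SZ}}(k_1,\dots,k_r)=\sum_{0<n_1<\cdots<n_r}\prod_{j=1}^r\frac{q^{n_jk_j}}{(1-q^{n_j})^{k_j}}\in\mathbb Q[[q]]$. With $\bar1$ a formal symbol, for $\boldsymbol k=(k_1,\dots,k_r)$ with entries in $\{\bar1\}\cup\mathbb Z_{\ge1}$ and ($r=0$ or $k_r\ne\bar1$), $\zeta_q^\dagger(\boldsymbol k)=\sum_{0<n_1\le\cdots\le n_r,\ n_i<n_{i+1}\text{ whenever }k_i\ne\bar1}\prod_{j:\,k_j\ne\bar1}\frac{q^{n_j}}{(1-q^{n_j})^{k_j}}$, with $\zeta_q^\dagger(\emptyset)=1$. -}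

module Defs where

open import Data.Nat as ℕ using (ℕ; zero; suc; _∸_; _≤_)
open import Data.Nat.Divisibility using (_∣?_)
open import Data.Nat.Combinatorics using (_C_)
open import Data.Integer as ℤ using (ℤ; +_; -_)
open import Data.List using (List; []; _∷_; _++_; map; upTo; foldr; replicate; concatMap)
open import Data.Vec using (Vec; []; _∷_)
open import Data.Vec.Relation.Unary.All using (All)
open import Relation.Binary.PropositionalEquality using (_≡_)
open import Relation.Nullary.Decidable using (does)
open import Data.Bool using (if_then_else_)

-- Formal power series in q with integer coefficients: coefficient maps.

PS : Set
PS = ℕ → ℤ

_≈ₚ_ : PS → PS → Set
f ≈ₚ g = ∀ N → f N ≡ g N

infix 4 _≈ₚ_

sumℤ : List ℤ → ℤ
sumℤ = foldr ℤ._+_ (+ 0)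

0ₚ : PS
0ₚ _ = + 0

1ₚ : PS
1ₚ zero    = + 1
1ₚ (suc _) = + 0

_⊕_ : PS → PS → PS
(f ⊕ g) N = f N ℤ.+ g N

_⊛_ : PS → PS → PS
(f ⊛ g) N = sumℤ (map (λ i → f i ℤ.* g (N ∸ i)) (upTo (suc N)))

scale : ℤ → PS → PS
scale c f N = c ℤ.* f N

ΣL : {A : Set} → List A → (A → PS) → PS
ΣL xs F = foldr (λ x acc → F x ⊕ acc) 0ₚ xs

_^ₚ_ : PS → ℕ → PS
f ^ₚ zero  = 1ₚ
f ^ₚ suc k = f ⊛ (f ^ₚ k)

mono : ℕ → PS
mono n d = if does (n ℕ.≟ d) then + 1 else + 0

-- 1/(1 - q^n) = Σ_{m ≥ 0} q^{n m}   (used for n ≥ 1)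
geom : ℕ → PS
geom n d = if does (n ∣? d) then + 1 else + 0

-- q^{nk}/(1-q^n)^k = (q^n/(1-q^n))^k
szFactor : ℕ → ℕ → PS
szFactor n k = (mono n ⊛ geom n) ^ₚ k

-- entries of ζ^†: the formal symbol 1̄, or a positive integer
data DEnt : Set where
  bar : DEnt
  ent : ℕ → DEnt

-- q^n/(1-q^n)^k for an entry k ≠ 1̄; factor 1 for 1̄
dagFactor : ℕ → DEnt → PS
dagFactor n bar     = 1ₚ
dagFactor n (ent k) = mono n ⊛ (geom n ^ₚ k)

range : ℕ → ℕ → List ℕ
range lo M = map (lo ℕ.+_) (upTo (suc M ∸ lo))

-- Σ over lo ≤ n_1 < n_2 < ... < n_r ≤ M of ∏ szFactor n_j k_j
szSum : List ℕ → ℕ → ℕ → PS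
szSum []       lo M = 1ₚ
szSum (k ∷ ks) lo M = ΣL (range lo M) (λ n → szFactor n k ⊛ szSum ks (suc n) M)

-- Σ over lo ≤ n_1 ≤ ... ≤ n_r ≤ M, with n_i < n_{i+1} whenever k_i ≠ 1̄
dagNext : DEnt → ℕ → ℕ
dagNext bar     n = n
dagNext (ent _) n = suc n

dagSum : List DEnt → ℕ → ℕ → PS
dagSum []       lo M = 1ₚ
dagSum (e ∷ es) lo M = ΣL (range lo M) (λ n → dagFactor n e ⊛ dagSum es (dagNext e n) M)

-- ζ_q^SZ(k_1,...,k_r): its coefficient of q^N. For admissible indices (k_r > 0)
-- only tuples with n_r ≤ N contribute to q^N, so truncating at N is exact.
ζSZ : List ℕ → PS
ζSZ ks N = szSum ks 1 N N

-- ζ_q^†(k): likewise (last entry ≠ 1̄ gives degree ≥ n_r ≥ all n_j).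
ζDag : List DEnt → PS
ζDag ks N = dagSum ks 1 N N

szIdx : {r : ℕ} → Vec ℕ r → Vec ℕ r → List ℕ
szIdx []       []       = []
szIdx (l ∷ ls) (k ∷ ks) = replicate (l ∸ 1) 0 ++ (k ∷ szIdx ls ks)

dagIdx : {r : ℕ} → Vec ℕ r → Vec ℕ r → List DEnt
dagIdx []       []       = []
dagIdx (l ∷ ls) (k ∷ ks) = replicate (l ∸ 1) bar ++ (ent k ∷ dagIdx ls ks)

dagVec : {r : ℕ} → Vec ℕ r → List DEnt
dagVec []       = []
dagVec (k ∷ ks) = ent k ∷ dagVec ks

toList : {r : ℕ} → Vec ℕ r → List ℕ
toList []       = []
toList (k ∷ ks) = k ∷ toList ks

-- all m' ∈ Z_{≥1}^r with m'_j ≤ m_j (outside this box b and b̄ vanish)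
box : {r : ℕ} → Vec ℕ r → List (Vec ℕ r)
box []       = [] ∷ []
box (m ∷ ms) = concatMap (λ i → map (suc i ∷_) (box ms)) (upTo m)

sgn : ℕ → ℤ
sgn zero    = + 1
sgn (suc n) = - sgn n

b : {r : ℕ} → Vec ℕ r → Vec ℕ r → ℤ
b []       []         = + 1
b (m ∷ ms) (m' ∷ ms') = + ((m ∸ 1) C (m' ∸ 1)) ℤ.* b ms ms'

-- b̄(m; m') = ∏ (-1)^{m_j - m'_j} binom(m_j - 1, m'_j - 1)   (evaluated for m' ≤ m)
bb : {r : ℕ} → Vec ℕ r → Vec ℕ r → ℤ
bb []       []         = + 1
bb (m ∷ ms) (m' ∷ ms') = (sgn (m ∸ m') ℤ.* + ((m ∸ 1) C (m' ∸ 1))) ℤ.* bb ms ms'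

Pos : {r : ℕ} → Vec ℕ r → Set
Pos = All (1 ≤_)

-- Put x = q^n/(1 - q^n) (geom⁺ n below), so that 1/(1 - q^n) = 1 + x. An entry k of ζ^† contributes
-- x (1 + x)^(k-1) and an entry k of ζ^SZ contributes x^k = x ((1 + x) - 1)^(k-1), so the binomial
-- theorem expands either factor in terms of the other, with coefficients C(k-1, i), resp.
-- (-1)^(k-1-i) C(k-1, i). In the same way the sum over a 1̄ entry (next index n' ≥ n, factor 1) is the
-- identity plus the sum over a 0 entry (n' > n, factor 1), on summands vanishing beyond the
-- truncation, so l - 1 copies of one expand binomially in copies of the other. Both expansions act
-- linearly on the nested sum to their right, and induction over the blocks ({1̄}^(l-1), k), resp.
-- ({0}^(l-1), k), multiplies the coefficients. All of this is proved for sums truncated at an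
-- arbitrary M, as identities between functions of the lowest summation bound; the coefficient of
-- q^N in ζ is the case M = N at bound 1.

module Submission where

open import Data.Bool using (if_then_else_)
open import Data.Integer using (ℤ; +_; -_; _+_; _*_; 1ℤ; -1ℤ)
import Data.Integer.Properties as ℤP
open import Data.Integer.Tactic.RingSolver using (solve-∀)
open import Data.List using (List; []; _∷_; [_]; _++_; map; upTo; concatMap; replicate)
import Data.List.Properties as ListP
open import Data.Nat as ℕ using (ℕ; zero; suc; _∸_; _<_; _≤?_; s≤s; z≤n)
open import Data.Nat.Combinatorics using (_C_; nCk+nC[k+1]≡[n+1]C[k+1]; k>n⇒nCk≡0)
open import Data.Nat.Divisibility using (_∣_; _∣?_; ∣-refl; ∣m∣n⇒∣m+n; ∣m+n∣m⇒∣n; >⇒∤)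
open import Data.Nat.GeneralisedArithmetic using (fold)
import Data.Nat.Properties as ℕP
open import Data.Product using (_×_; _,_)
open import Data.Vec using (Vec; []; _∷_)
import Data.Vec as Vec
open import Data.Vec.Relation.Unary.All using ([]; _∷_)
open import Function using (_∘_)
open import Function.Bundles using (mk⇔)
open import Relation.Binary.Bundles using (Setoid)
open import Relation.Binary.PropositionalEquality using (_≡_; refl; sym; trans; cong; cong₂; module ≡-Reasoning)
import Relation.Binary.Reasoning.Setoid as SetoidReasoning
open import Relation.Nullary.Decidable using (yes; no; does-⇔; dec-false)
open import Algebra.Properties.CommutativeSemigroup ℤP.+-commutativeSemigroup
  using () renaming (interchange to +-interchange; x∙yz≈y∙xz to +-leftComm)
open import Algebra.Properties.CommutativeSemigroup ℤP.*-commutativeSemigroup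
  using () renaming (x∙yz≈y∙xz to *-leftComm)

open import Defs

private
  variable
    A B A′ B′ : Set

-- Finite sums of integers

Σℤ : List A → (A → ℤ) → ℤ
Σℤ xs f = sumℤ (map f xs)

Σℤ-cong : (xs : List A) {f g : A → ℤ} → (∀ x → f x ≡ g x) → Σℤ xs f ≡ Σℤ xs g
Σℤ-cong []       f≡g = refl
Σℤ-cong (x ∷ xs) f≡g = cong₂ _+_ (f≡g x) (Σℤ-cong xs f≡g)

Σℤ-zero : (xs : List A) → Σℤ xs (λ _ → + 0) ≡ + 0
Σℤ-zero []       = refl
Σℤ-zero (x ∷ xs) = trans (ℤP.+-identityˡ _) (Σℤ-zero xs)

Σℤ-distrib-+ : (xs : List A) (f g : A → ℤ) → Σℤ xs (λ x → f x + g x) ≡ Σℤ xs f + Σℤ xs g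
Σℤ-distrib-+ []       f g = refl
Σℤ-distrib-+ (x ∷ xs) f g =
  trans (cong (_+_ (f x + g x)) (Σℤ-distrib-+ xs f g)) (+-interchange (f x) (g x) _ _)

*-distribˡ-Σℤ : (c : ℤ) (xs : List A) (f : A → ℤ) → c * Σℤ xs f ≡ Σℤ xs (λ x → c * f x)
*-distribˡ-Σℤ c []       f = ℤP.*-zeroʳ c
*-distribˡ-Σℤ c (x ∷ xs) f =
  trans (ℤP.*-distribˡ-+ c (f x) (Σℤ xs f)) (cong (_+_ (c * f x)) (*-distribˡ-Σℤ c xs f))

Σℤ-comm : (xs : List A) (ys : List B) (f : A → B → ℤ) →
          Σℤ xs (λ x → Σℤ ys (f x)) ≡ Σℤ ys (λ y → Σℤ xs (λ x → f x y))
Σℤ-comm []       ys f = sym (Σℤ-zero ys)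
Σℤ-comm (x ∷ xs) ys f = trans (cong (_+_ (Σℤ ys (f x))) (Σℤ-comm xs ys f))
                              (sym (Σℤ-distrib-+ ys (f x) _))

Σℤ-++ : (xs ys : List A) (f : A → ℤ) → Σℤ (xs ++ ys) f ≡ Σℤ xs f + Σℤ ys f
Σℤ-++ []       ys f = sym (ℤP.+-identityˡ _)
Σℤ-++ (x ∷ xs) ys f = trans (cong (_+_ (f x)) (Σℤ-++ xs ys f)) (sym (ℤP.+-assoc (f x) _ _))

Σℤ-map : (g : A → B) (xs : List A) (f : B → ℤ) → Σℤ (map g xs) f ≡ Σℤ xs (f ∘ g)
Σℤ-map g xs f = cong sumℤ (sym (ListP.map-∘ xs))

Σℤ-concatMap : (g : A → List B) (xs : List A) (f : B → ℤ) →
               Σℤ (concatMap g xs) f ≡ Σℤ xs (λ x → Σℤ (g x) f)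
Σℤ-concatMap g []       f = refl
Σℤ-concatMap g (x ∷ xs) f =
  trans (Σℤ-++ (g x) (concatMap g xs) f) (cong (_+_ (Σℤ (g x) f)) (Σℤ-concatMap g xs f))

Σℤ-upTo-suc : (n : ℕ) (f : ℕ → ℤ) → Σℤ (upTo (suc n)) f ≡ f 0 + Σℤ (upTo n) (f ∘ suc)
Σℤ-upTo-suc n f = cong (λ xs → f 0 + sumℤ xs)
  (trans (ListP.map-applyUpTo suc f n) (sym (ListP.map-applyUpTo (λ i → i) (f ∘ suc) n)))

Σℤ-upTo-sucʳ : (n : ℕ) (f : ℕ → ℤ) → Σℤ (upTo (suc n)) f ≡ Σℤ (upTo n) f + f n
Σℤ-upTo-sucʳ n f = begin
  Σℤ (upTo (suc n)) f           ≡⟨ cong (λ xs → Σℤ xs f) (ListP.upTo-∷ʳ n) ⟨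
  Σℤ (upTo n ++ [ n ]) f        ≡⟨ Σℤ-++ (upTo n) [ n ] f ⟩
  Σℤ (upTo n) f + (f n + + 0)   ≡⟨ cong (_+_ (Σℤ (upTo n) f)) (ℤP.+-identityʳ (f n)) ⟩
  Σℤ (upTo n) f + f n           ∎
  where open ≡-Reasoning

Σℤ-upTo-shift : (u : ℕ) (f : ℕ → ℤ) → f u ≡ + 0 → Σℤ (upTo u) f ≡ f 0 + Σℤ (upTo u) (f ∘ suc)
Σℤ-upTo-shift zero    f f0≡0 = sym (trans (ℤP.+-identityʳ (f 0)) f0≡0)
Σℤ-upTo-shift (suc u) f fu≡0 = begin
  Σℤ (upTo (suc u)) f                             ≡⟨ Σℤ-upTo-suc u f ⟩
  f 0 + Σℤ (upTo u) (f ∘ suc)                     ≡⟨ cong (_+_ (f 0)) (ℤP.+-identityʳ _) ⟨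
  f 0 + (Σℤ (upTo u) (f ∘ suc) + + 0)             ≡⟨ cong (λ z → f 0 + (Σℤ (upTo u) (f ∘ suc) + z)) fu≡0 ⟨
  f 0 + (Σℤ (upTo u) (f ∘ suc) + f (suc u))       ≡⟨ cong (_+_ (f 0)) (Σℤ-upTo-sucʳ u (f ∘ suc)) ⟨
  f 0 + Σℤ (upTo (suc u)) (f ∘ suc)               ∎
  where open ≡-Reasoning

Σℤ-box-∷ : {r : ℕ} (m : ℕ) (ms : Vec ℕ r) (f : Vec ℕ (suc r) → ℤ) →
           Σℤ (box (m ∷ ms)) f ≡ Σℤ (upTo m) (λ i → Σℤ (box ms) (λ v → f (suc i ∷ v)))
Σℤ-box-∷ m ms f = trans (Σℤ-concatMap (λ i → map (suc i ∷_) (box ms)) (upTo m) f)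
                        (Σℤ-cong (upTo m) (λ i → Σℤ-map (suc i ∷_) (box ms) f))

*-distribˡ-Σℤ² : (c : ℤ) (xs : List A) (ys : List B) (f : A → B → ℤ) →
                 c * Σℤ xs (λ x → Σℤ ys (f x)) ≡ Σℤ xs (λ x → Σℤ ys (λ y → c * f x y))
*-distribˡ-Σℤ² c xs ys f = trans (*-distribˡ-Σℤ c xs _) (Σℤ-cong xs (λ x → *-distribˡ-Σℤ c ys (f x)))

Σℤ-interleave : (I K : List A) (xs : List A′) (ys : List B′) (a a′ : A → ℤ) (w : A′ → ℤ) (w′ : B′ → ℤ)
  (g : A → A → A′ → B′ → ℤ) →
  Σℤ I (λ i → a i * Σℤ K (λ i′ → a′ i′ * Σℤ xs (λ x → Σℤ ys (λ y → (w x * w′ y) * g i i′ x y)))) ≡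
  Σℤ I (λ i → Σℤ xs (λ x → Σℤ K (λ i′ → Σℤ ys (λ y → (a i * w x * (a′ i′ * w′ y)) * g i i′ x y))))
Σℤ-interleave I K xs ys a a′ w w′ g = Σℤ-cong I λ i → begin
  a i * Σℤ K (λ i′ → a′ i′ * Σℤ xs (λ x → Σℤ ys (λ y → (w x * w′ y) * g i i′ x y)))
    ≡⟨ *-distribˡ-Σℤ (a i) K _ ⟩
  Σℤ K (λ i′ → a i * (a′ i′ * Σℤ xs (λ x → Σℤ ys (λ y → (w x * w′ y) * g i i′ x y))))
    ≡⟨ Σℤ-cong K (λ i′ → trans (cong (a i *_) (*-distribˡ-Σℤ² (a′ i′) xs ys _)) (*-distribˡ-Σℤ² (a i) xs ys _)) ⟩
  Σℤ K (λ i′ → Σℤ xs (λ x → Σℤ ys (λ y → a i * (a′ i′ * ((w x * w′ y) * g i i′ x y)))))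
    ≡⟨ Σℤ-comm K xs _ ⟩
  Σℤ xs (λ x → Σℤ K (λ i′ → Σℤ ys (λ y → a i * (a′ i′ * ((w x * w′ y) * g i i′ x y)))))
    ≡⟨ Σℤ-cong xs (λ x → Σℤ-cong K (λ i′ → Σℤ-cong ys (λ y → rearrange (a i) (a′ i′) (w x) (w′ y) (g i i′ x y)))) ⟩
  Σℤ xs (λ x → Σℤ K (λ i′ → Σℤ ys (λ y → (a i * w x * (a′ i′ * w′ y)) * g i i′ x y))) ∎
  where
  open ≡-Reasoning
  rearrange : ∀ u u′ v v′ h → u * (u′ * ((v * v′) * h)) ≡ (u * v * (u′ * v′)) * h
  rearrange = solve-∀

ΣL-at : (xs : List A) (F : A → PS) (N : ℕ) → ΣL xs F N ≡ Σℤ xs (λ x → F x N)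
ΣL-at []       F N = refl
ΣL-at (x ∷ xs) F N = cong (_+_ (F x N)) (ΣL-at xs F N)

ΣL²-at : (xs : List A) (ys : List B) (c : A → B → ℤ) (H : A → B → PS) (N : ℕ) →
  ΣL xs (λ x → ΣL ys (λ y → scale (c x y) (H x y))) N ≡ Σℤ xs (λ x → Σℤ ys (λ y → c x y * H x y N))
ΣL²-at xs ys c H N = trans (ΣL-at xs (λ x → ΣL ys (λ y → scale (c x y) (H x y))) N)
                           (Σℤ-cong xs (λ x → ΣL-at ys (λ y → scale (c x y) (H x y)) N))

-- Formal power series

≈ₚ-setoid : Setoid _ _
≈ₚ-setoid = record
  { Carrier       = PS
  ; _≈_           = _≈ₚ_
  ; isEquivalence = record
    { refl  = λ _ → refl
    ; sym   = λ f≈g N → sym (f≈g N)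
    ; trans = λ f≈g g≈h N → trans (f≈g N) (g≈h N)
    }
  }

open Setoid ≈ₚ-setoid using () renaming (refl to ≈ₚ-refl; sym to ≈ₚ-sym; trans to ≈ₚ-trans)

tailₚ : PS → PS
tailₚ f N = f (suc N)

⊛-suc : (f g : PS) (N : ℕ) → (f ⊛ g) (suc N) ≡ f 0 * g (suc N) + (tailₚ f ⊛ g) N
⊛-suc f g N = Σℤ-upTo-suc (suc N) (λ i → f i * g (suc N ∸ i))

⊛-cong : {f f′ g g′ : PS} → f ≈ₚ f′ → g ≈ₚ g′ → f ⊛ g ≈ₚ f′ ⊛ g′
⊛-cong f≈f′ g≈g′ N = Σℤ-cong (upTo (suc N)) (λ i → cong₂ _*_ (f≈f′ i) (g≈g′ (N ∸ i)))

⊛-distribˡ-⊕ : (f g h : PS) → f ⊛ (g ⊕ h) ≈ₚ (f ⊛ g) ⊕ (f ⊛ h)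
⊛-distribˡ-⊕ f g h N =
  trans (Σℤ-cong (upTo (suc N)) (λ i → ℤP.*-distribˡ-+ (f i) (g (N ∸ i)) (h (N ∸ i))))
        (Σℤ-distrib-+ (upTo (suc N)) (λ i → f i * g (N ∸ i)) (λ i → f i * h (N ∸ i)))

⊛-distribʳ-⊕ : (f g h : PS) → (f ⊕ g) ⊛ h ≈ₚ (f ⊛ h) ⊕ (g ⊛ h)
⊛-distribʳ-⊕ f g h N =
  trans (Σℤ-cong (upTo (suc N)) (λ i → ℤP.*-distribʳ-+ (h (N ∸ i)) (f i) (g i)))
        (Σℤ-distrib-+ (upTo (suc N)) (λ i → f i * h (N ∸ i)) (λ i → g i * h (N ∸ i)))

⊛-scaleˡ : (c : ℤ) (f g : PS) → scale c f ⊛ g ≈ₚ scale c (f ⊛ g)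
⊛-scaleˡ c f g N = trans (Σℤ-cong (upTo (suc N)) (λ i → ℤP.*-assoc c (f i) _))
                         (sym (*-distribˡ-Σℤ c (upTo (suc N)) _))

⊛-scaleʳ : (c : ℤ) (f g : PS) → f ⊛ scale c g ≈ₚ scale c (f ⊛ g)
⊛-scaleʳ c f g N = trans (Σℤ-cong (upTo (suc N)) (λ i → *-leftComm (f i) c _))
                         (sym (*-distribˡ-Σℤ c (upTo (suc N)) _))

⊛-zeroˡ : (g : PS) → 0ₚ ⊛ g ≈ₚ 0ₚ
⊛-zeroˡ g N = trans (Σℤ-cong (upTo (suc N)) (λ i → ℤP.*-zeroˡ (g (N ∸ i)))) (Σℤ-zero (upTo (suc N)))

⊛-zeroʳ : (f : PS) → f ⊛ 0ₚ ≈ₚ 0ₚ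
⊛-zeroʳ f N = trans (Σℤ-cong (upTo (suc N)) (λ i → ℤP.*-zeroʳ (f i))) (Σℤ-zero (upTo (suc N)))

⊛-identityˡ : (f : PS) → 1ₚ ⊛ f ≈ₚ f
⊛-identityˡ f zero    = trans (ℤP.+-identityʳ _) (ℤP.*-identityˡ (f 0))
⊛-identityˡ f (suc N) = begin
  (1ₚ ⊛ f) (suc N)                    ≡⟨ ⊛-suc 1ₚ f N ⟩
  + 1 * f (suc N) + (0ₚ ⊛ f) N        ≡⟨ cong₂ _+_ (ℤP.*-identityˡ (f (suc N))) (⊛-zeroˡ f N) ⟩
  f (suc N) + + 0                     ≡⟨ ℤP.+-identityʳ (f (suc N)) ⟩
  f (suc N)                           ∎
  where open ≡-Reasoning

⊛-comm : (f g : PS) → f ⊛ g ≈ₚ g ⊛ f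
⊛-comm f g zero          = cong (_+ + 0) (ℤP.*-comm (f 0) (g 0))
⊛-comm f g (suc zero)    = begin
  f 0 * g 1 + (f 1 * g 0 + + 0)       ≡⟨ cong₂ (λ u v → u + (v + + 0)) (ℤP.*-comm (f 0) (g 1)) (ℤP.*-comm (f 1) (g 0)) ⟩
  g 1 * f 0 + (g 0 * f 1 + + 0)       ≡⟨ +-leftComm (g 1 * f 0) (g 0 * f 1) (+ 0) ⟩
  g 0 * f 1 + (g 1 * f 0 + + 0)       ∎
  where open ≡-Reasoning
⊛-comm f g (suc (suc N)) = begin
  (f ⊛ g) N₂                                            ≡⟨ ⊛-suc f g (suc N) ⟩
  f 0 * g N₂ + (tailₚ f ⊛ g) (suc N)                    ≡⟨ cong (_+_ (f 0 * g N₂)) (⊛-comm (tailₚ f) g (suc N)) ⟩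
  f 0 * g N₂ + (g ⊛ tailₚ f) (suc N)                    ≡⟨ cong (_+_ (f 0 * g N₂)) (⊛-suc g (tailₚ f) N) ⟩
  f 0 * g N₂ + (g 0 * f N₂ + (tailₚ g ⊛ tailₚ f) N)     ≡⟨ cong (λ h → f 0 * g N₂ + (g 0 * f N₂ + h))
                                                                 (⊛-comm (tailₚ g) (tailₚ f) N) ⟩
  f 0 * g N₂ + (g 0 * f N₂ + (tailₚ f ⊛ tailₚ g) N)     ≡⟨ +-leftComm (f 0 * g N₂) (g 0 * f N₂) _ ⟩
  g 0 * f N₂ + (f 0 * g N₂ + (tailₚ f ⊛ tailₚ g) N)     ≡⟨ cong (_+_ (g 0 * f N₂)) (⊛-suc f (tailₚ g) N) ⟨
  g 0 * f N₂ + (f ⊛ tailₚ g) (suc N)                    ≡⟨ cong (_+_ (g 0 * f N₂)) (⊛-comm f (tailₚ g) (suc N)) ⟩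
  g 0 * f N₂ + (tailₚ g ⊛ f) (suc N)                    ≡⟨ ⊛-suc g f (suc N) ⟨
  (g ⊛ f) N₂                                            ∎
  where
  open ≡-Reasoning
  N₂ : ℕ
  N₂ = suc (suc N)

⊛-assoc : (f g h : PS) → (f ⊛ g) ⊛ h ≈ₚ f ⊛ (g ⊛ h)
⊛-assoc f g h zero    = cong (_+ + 0) (begin
  (f 0 * g 0 + + 0) * h 0   ≡⟨ cong (_* h 0) (ℤP.+-identityʳ (f 0 * g 0)) ⟩
  f 0 * g 0 * h 0           ≡⟨ ℤP.*-assoc (f 0) (g 0) (h 0) ⟩
  f 0 * (g 0 * h 0)         ≡⟨ cong (f 0 *_) (ℤP.+-identityʳ (g 0 * h 0)) ⟨
  f 0 * (g 0 * h 0 + + 0)   ∎)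
  where open ≡-Reasoning
⊛-assoc f g h (suc N) = begin
  ((f ⊛ g) ⊛ h) (suc N)
    ≡⟨ ⊛-suc (f ⊛ g) h N ⟩
  (f ⊛ g) 0 * h (suc N) + (tailₚ (f ⊛ g) ⊛ h) N
    ≡⟨ cong (_+_ ((f ⊛ g) 0 * h (suc N))) (⊛-cong {g = h} (⊛-suc f g) ≈ₚ-refl N) ⟩
  (f ⊛ g) 0 * h (suc N) + ((scale (f 0) (tailₚ g) ⊕ (tailₚ f ⊛ g)) ⊛ h) N
    ≡⟨ cong (_+_ ((f ⊛ g) 0 * h (suc N))) (trans (⊛-distribʳ-⊕ (scale (f 0) (tailₚ g)) (tailₚ f ⊛ g) h N)
         (cong₂ _+_ (⊛-scaleˡ (f 0) (tailₚ g) h N) (⊛-assoc (tailₚ f) g h N))) ⟩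
  (f 0 * g 0 + + 0) * h (suc N) + (f 0 * (tailₚ g ⊛ h) N + (tailₚ f ⊛ (g ⊛ h)) N)
    ≡⟨ regroup (f 0) (g 0) (h (suc N)) _ _ ⟩
  f 0 * (g 0 * h (suc N) + (tailₚ g ⊛ h) N) + (tailₚ f ⊛ (g ⊛ h)) N
    ≡⟨ cong (λ z → f 0 * z + (tailₚ f ⊛ (g ⊛ h)) N) (⊛-suc g h N) ⟨
  f 0 * (g ⊛ h) (suc N) + (tailₚ f ⊛ (g ⊛ h)) N
    ≡⟨ ⊛-suc f (g ⊛ h) N ⟨
  (f ⊛ (g ⊛ h)) (suc N) ∎
  where
  open ≡-Reasoning
  regroup : ∀ a b c u v → (a * b + + 0) * c + (a * u + v) ≡ a * (b * c + u) + v
  regroup = solve-∀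

⊛-leftComm : (f g h : PS) → f ⊛ (g ⊛ h) ≈ₚ g ⊛ (f ⊛ h)
⊛-leftComm f g h = begin
  f ⊛ (g ⊛ h)   ≈⟨ ⊛-assoc f g h ⟨
  (f ⊛ g) ⊛ h   ≈⟨ ⊛-cong (⊛-comm f g) ≈ₚ-refl ⟩
  (g ⊛ f) ⊛ h   ≈⟨ ⊛-assoc g f h ⟩
  g ⊛ (f ⊛ h)   ∎
  where open SetoidReasoning ≈ₚ-setoid

-- Monomials and geometric series

shift : ℕ → PS → PS
shift zero    f         = f
shift (suc n) f zero    = + 0
shift (suc n) f (suc d) = shift n f d

shift-< : (n : ℕ) (f : PS) {d : ℕ} → d < n → shift n f d ≡ + 0
shift-< (suc n) f {zero}  _         = refl
shift-< (suc n) f {suc d} (s≤s d<n) = shift-< n f d<n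

shift-+ : (n : ℕ) (f : PS) (e : ℕ) → shift n f (n ℕ.+ e) ≡ f e
shift-+ zero    f e = refl
shift-+ (suc n) f e = shift-+ n f e

mono-⊛ : (n : ℕ) (f : PS) → mono n ⊛ f ≈ₚ shift n f
mono-⊛ zero    f         = ≈ₚ-trans (⊛-cong {g = f} mono-0 ≈ₚ-refl) (⊛-identityˡ f)
  where
  mono-0 : mono 0 ≈ₚ 1ₚ
  mono-0 zero    = refl
  mono-0 (suc d) = refl
mono-⊛ (suc n) f zero    = trans (ℤP.+-identityʳ _) (ℤP.*-zeroˡ (f 0))
mono-⊛ (suc n) f (suc N) = begin
  (mono (suc n) ⊛ f) (suc N)                  ≡⟨ ⊛-suc (mono (suc n)) f N ⟩
  + 0 * f (suc N) + (mono n ⊛ f) N            ≡⟨ ℤP.+-identityˡ _ ⟩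
  (mono n ⊛ f) N                              ≡⟨ mono-⊛ n f N ⟩
  shift n f N                                 ∎
  where open ≡-Reasoning

geom-∣ : (n : ℕ) {d d′ : ℕ} → (n ∣ d → n ∣ d′) → (n ∣ d′ → n ∣ d) → geom n d ≡ geom n d′
geom-∣ n {d} {d′} to from = cong (if_then + 1 else + 0) (does-⇔ (mk⇔ to from) (n ∣? d) (n ∣? d′))

geom⁺ : ℕ → PS
geom⁺ n = mono n ⊛ geom n

geom-unfold : (n : ℕ) → geom (suc n) ≈ₚ 1ₚ ⊕ geom⁺ (suc n)
geom-unfold n d = trans (unfold-at d) (cong (_+_ (1ₚ d)) (sym (mono-⊛ (suc n) g d)))
  where
  g : PS
  g = geom (suc n)
  unfold-at : ∀ d → g d ≡ 1ₚ d + shift (suc n) g d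
  unfold-at d with suc n ≤? d
  ... | yes n<d with ℕP.m≤n⇒∃[o]m+o≡n n<d
  ...   | e , refl = trans (geom-∣ (suc n) (λ p → ∣m+n∣m⇒∣n p ∣-refl) (∣m∣n⇒∣m+n ∣-refl))
                           (sym (trans (ℤP.+-identityˡ _) (shift-+ (suc n) g e)))
  unfold-at zero    | no _   = refl
  unfold-at (suc d) | no n≮d = trans (cong (if_then + 1 else + 0) (dec-false (suc n ∣? suc d) (>⇒∤ (ℕP.≰⇒> n≮d))))
                                     (sym (trans (ℤP.+-identityˡ _) (shift-< (suc n) g (ℕP.≰⇒> n≮d))))

geom-⊛ : (n : ℕ) (f : PS) → geom (suc n) ⊛ f ≈ₚ f ⊕ (geom⁺ (suc n) ⊛ f)
geom-⊛ n f = begin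
  geom (suc n) ⊛ f                        ≈⟨ ⊛-cong {g = f} (geom-unfold n) ≈ₚ-refl ⟩
  (1ₚ ⊕ geom⁺ (suc n)) ⊛ f                ≈⟨ ⊛-distribʳ-⊕ 1ₚ (geom⁺ (suc n)) f ⟩
  (1ₚ ⊛ f) ⊕ (geom⁺ (suc n) ⊛ f)          ≈⟨ (λ N → cong (_+ (geom⁺ (suc n) ⊛ f) N) (⊛-identityˡ f N)) ⟩
  f ⊕ (geom⁺ (suc n) ⊛ f)                 ∎
  where open SetoidReasoning ≈ₚ-setoid

-- binom β j i is the coefficient of Y^i in (β + Y)^j.
binom : ℤ → ℕ → ℕ → ℤ
binom β zero    zero    = + 1
binom β zero    (suc i) = + 0
binom β (suc j) zero    = β * binom β j zero
binom β (suc j) (suc i) = binom β j i + β * binom β j (suc i)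

binom-vanish : (β : ℤ) {j i : ℕ} → j < i → binom β j i ≡ + 0
binom-vanish β {zero}  {suc i} _         = refl
binom-vanish β {suc j} {suc i} (s≤s j<i) = begin
  binom β j i + β * binom β j (suc i)   ≡⟨ cong₂ (λ u v → u + β * v) (binom-vanish β j<i) (binom-vanish β (ℕP.m<n⇒m<1+n j<i)) ⟩
  + 0 + β * + 0                         ≡⟨ trans (ℤP.+-identityˡ _) (ℤP.*-zeroʳ β) ⟩
  + 0                                   ∎
  where open ≡-Reasoning

binom-pascal : (β : ℤ) (j : ℕ) (y : ℕ → ℤ) →
  Σℤ (upTo (suc j)) (λ i → binom β j i * (β * y i + y (suc i))) ≡ Σℤ (upTo (suc (suc j))) (λ i → binom β (suc j) i * y i)
binom-pascal β j y = begin
  Σℤ I (λ i → c i * (β * y i + y (suc i)))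
    ≡⟨ Σℤ-cong I (λ i → expand β (c i) (y i) (y (suc i))) ⟩
  Σℤ I (λ i → β * (c i * y i) + c i * y (suc i))
    ≡⟨ Σℤ-distrib-+ I (λ i → β * (c i * y i)) (λ i → c i * y (suc i)) ⟩
  Σℤ I (λ i → β * (c i * y i)) + S₂
    ≡⟨ cong (_+ S₂) (*-distribˡ-Σℤ β I (λ i → c i * y i)) ⟨
  β * Σℤ I (λ i → c i * y i) + S₂
    ≡⟨ cong (λ z → β * z + S₂) (Σℤ-upTo-shift (suc j) (λ i → c i * y i) top-vanishes) ⟩
  β * (c 0 * y 0 + S₁) + S₂
    ≡⟨ regroup β (c 0) (y 0) S₁ S₂ ⟩
  β * c 0 * y 0 + (S₂ + β * S₁)
    ≡⟨ cong (λ z → β * c 0 * y 0 + (S₂ + z)) (*-distribˡ-Σℤ β I (λ i → c (suc i) * y (suc i))) ⟩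
  β * c 0 * y 0 + (S₂ + Σℤ I (λ i → β * (c (suc i) * y (suc i))))
    ≡⟨ cong (_+_ (β * c 0 * y 0)) (Σℤ-distrib-+ I (λ i → c i * y (suc i)) (λ i → β * (c (suc i) * y (suc i)))) ⟨
  β * c 0 * y 0 + Σℤ I (λ i → c i * y (suc i) + β * (c (suc i) * y (suc i)))
    ≡⟨ cong (_+_ (β * c 0 * y 0)) (Σℤ-cong I (λ i → factor β (c i) (c (suc i)) (y (suc i)))) ⟩
  β * c 0 * y 0 + Σℤ I (λ i → binom β (suc j) (suc i) * y (suc i))
    ≡⟨ Σℤ-upTo-suc (suc j) (λ i → binom β (suc j) i * y i) ⟨
  Σℤ (upTo (suc (suc j))) (λ i → binom β (suc j) i * y i) ∎
  where
  open ≡-Reasoning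
  I : List ℕ
  I = upTo (suc j)
  c : ℕ → ℤ
  c = binom β j
  S₁ S₂ : ℤ
  S₁ = Σℤ I (λ i → c (suc i) * y (suc i))
  S₂ = Σℤ I (λ i → c i * y (suc i))
  top-vanishes : c (suc j) * y (suc j) ≡ + 0
  top-vanishes = trans (cong (_* y (suc j)) (binom-vanish β (ℕP.n<1+n j))) (ℤP.*-zeroˡ (y (suc j)))
  expand : ∀ b a u v → a * (b * u + v) ≡ b * (a * u) + a * v
  expand = solve-∀
  regroup : ∀ b a u s t → b * (a * u + s) + t ≡ b * a * u + (t + b * s)
  regroup = solve-∀
  factor : ∀ b a a′ v → a * v + b * (a′ * v) ≡ (a + b * a′) * v
  factor = solve-∀

binom-[1ℤ] : (j i : ℕ) → binom 1ℤ j i ≡ + (j C i)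
binom-[1ℤ] zero    zero    = refl
binom-[1ℤ] zero    (suc i) = refl
binom-[1ℤ] (suc j) zero    = trans (ℤP.*-identityˡ _) (binom-[1ℤ] j zero)
binom-[1ℤ] (suc j) (suc i) = trans (cong₂ _+_ (binom-[1ℤ] j i) (trans (ℤP.*-identityˡ _) (binom-[1ℤ] j (suc i))))
                                   (cong +_ (nCk+nC[k+1]≡[n+1]C[k+1] j i))

sgn-∸-suc : {j i : ℕ} → i < j → - sgn (j ∸ suc i) ≡ sgn (j ∸ i)
sgn-∸-suc {suc j} {zero}  _         = refl
sgn-∸-suc {suc j} {suc i} (s≤s i<j) = sgn-∸-suc i<j

binom-[-1ℤ] : (j i : ℕ) → binom -1ℤ j i ≡ sgn (j ∸ i) * + (j C i)
binom-[-1ℤ] zero    zero    = refl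
binom-[-1ℤ] zero    (suc i) = refl
binom-[-1ℤ] (suc j) zero    = begin
  -1ℤ * binom -1ℤ j zero      ≡⟨ cong (-1ℤ *_) (binom-[-1ℤ] j zero) ⟩
  -1ℤ * (sgn j * + 1)         ≡⟨ ℤP.-1*i≡-i _ ⟩
  - (sgn j * + 1)             ≡⟨ ℤP.neg-distribˡ-* (sgn j) (+ 1) ⟩
  - sgn j * + 1               ∎
  where open ≡-Reasoning
binom-[-1ℤ] (suc j) (suc i) = begin
  binom -1ℤ j i + -1ℤ * binom -1ℤ j (suc i)
    ≡⟨ cong₂ (λ u v → u + -1ℤ * v) (binom-[-1ℤ] j i) (binom-[-1ℤ] j (suc i)) ⟩
  sgn (j ∸ i) * + (j C i) + -1ℤ * (sgn (j ∸ suc i) * + (j C suc i))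
    ≡⟨ cong (_+_ (sgn (j ∸ i) * + (j C i))) negate-last ⟩
  sgn (j ∸ i) * + (j C i) + sgn (j ∸ i) * + (j C suc i)
    ≡⟨ ℤP.*-distribˡ-+ (sgn (j ∸ i)) _ _ ⟨
  sgn (j ∸ i) * (+ (j C i) + + (j C suc i))
    ≡⟨ cong (λ m → sgn (j ∸ i) * + m) (nCk+nC[k+1]≡[n+1]C[k+1] j i) ⟩
  sgn (j ∸ i) * + (suc j C suc i) ∎
  where
  open ≡-Reasoning
  negate-last : -1ℤ * (sgn (j ∸ suc i) * + (j C suc i)) ≡ sgn (j ∸ i) * + (j C suc i)
  negate-last with i ℕ.<? j
  ... | yes i<j = begin
    -1ℤ * (sgn (j ∸ suc i) * + (j C suc i))    ≡⟨ ℤP.-1*i≡-i _ ⟩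
    - (sgn (j ∸ suc i) * + (j C suc i))        ≡⟨ ℤP.neg-distribˡ-* (sgn (j ∸ suc i)) _ ⟩
    - sgn (j ∸ suc i) * + (j C suc i)          ≡⟨ cong (_* + (j C suc i)) (sgn-∸-suc i<j) ⟩
    sgn (j ∸ i) * + (j C suc i)                ∎
  ... | no  i≮j rewrite k>n⇒nCk≡0 (s≤s (ℕP.≮⇒≥ i≮j)) =
    trans (cong (-1ℤ *_) (ℤP.*-zeroʳ (sgn (j ∸ suc i)))) (sym (ℤP.*-zeroʳ (sgn (j ∸ i))))

-1ℤ*p+[p+q]≡q : (p q : ℤ) → -1ℤ * p + (p + q) ≡ q
-1ℤ*p+[p+q]≡q = solve-∀

-- Families of power series indexed by the lowest summation bound

Fam : Set
Fam = ℕ → PS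

-- Families are compared at positive indices only, the range of the summation
-- variables n_j: at n = 0 the series geom 0 is 1ₚ, not 1/(1 - q⁰).
record _≋_ (F G : Fam) : Set where
  constructor pos≈
  field at : ∀ n → F (suc n) ≈ₚ G (suc n)
open _≋_ public

infix 4 _≋_

≋-setoid : Setoid _ _
≋-setoid = record
  { Carrier       = Fam
  ; _≈_           = _≋_
  ; isEquivalence = record
    { refl  = pos≈ λ _ _ → refl
    ; sym   = λ F≋G → pos≈ λ n N → sym (at F≋G n N)
    ; trans = λ F≋G G≋H → pos≈ λ n N → trans (at F≋G n N) (at G≋H n N)
    }
  }

open Setoid ≋-setoid public using () renaming (refl to ≋-refl; sym to ≋-sym; trans to ≋-trans; reflexive to ≋-reflexive)

infixl 6 _⊕ᶠ_
infixr 7 _·_ _⊛ᶠ_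

_⊕ᶠ_ : Fam → Fam → Fam
(F ⊕ᶠ G) n = F n ⊕ G n

_·_ : ℤ → Fam → Fam
(c · F) n = scale c (F n)

_⊛ᶠ_ : Fam → Fam → Fam
(F ⊛ᶠ G) n = F n ⊛ G n

0ᶠ : Fam
0ᶠ n = 0ₚ

Σᶠ : List A → (A → Fam) → Fam
Σᶠ xs F n N = Σℤ xs (λ x → F x n N)

⊕ᶠ-cong : {F F′ G G′ : Fam} → F ≋ F′ → G ≋ G′ → F ⊕ᶠ G ≋ F′ ⊕ᶠ G′
⊕ᶠ-cong F≋F′ G≋G′ = pos≈ λ n N → cong₂ _+_ (at F≋F′ n N) (at G≋G′ n N)

·-cong : (c : ℤ) {F G : Fam} → F ≋ G → c · F ≋ c · G
·-cong c F≋G = pos≈ λ n N → cong (c *_) (at F≋G n N)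

Σᶠ-cong : (xs : List A) {F G : A → Fam} → (∀ x → F x ≋ G x) → Σᶠ xs F ≋ Σᶠ xs G
Σᶠ-cong xs F≋G = pos≈ λ n N → Σℤ-cong xs (λ x → at (F≋G x) n N)

Σᶠ-box-∷ : {r : ℕ} (m : ℕ) (ms : Vec ℕ r) (F : Vec ℕ (suc r) → Fam) →
           Σᶠ (box (m ∷ ms)) F ≋ Σᶠ (upTo m) (λ i → Σᶠ (box ms) (λ v → F (suc i ∷ v)))
Σᶠ-box-∷ m ms F = pos≈ λ n N → Σℤ-box-∷ m ms (λ v → F v (suc n) N)

record Linear (T : Fam → Fam) : Set where
  field
    cong-≋ : {F G : Fam} → F ≋ G → T F ≋ T G
    ⊕-hom  : (F G : Fam) → T (F ⊕ᶠ G) ≋ T F ⊕ᶠ T G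
    ·-hom  : (c : ℤ) (F : Fam) → T (c · F) ≋ c · T F
    0-hom  : T 0ᶠ ≋ 0ᶠ

  Σ-hom : (xs : List A) (F : A → Fam) → T (Σᶠ xs F) ≋ Σᶠ xs (T ∘ F)
  Σ-hom []       F = 0-hom
  Σ-hom (x ∷ xs) F = ≋-trans (⊕-hom (F x) (Σᶠ xs F)) (⊕ᶠ-cong (≋-refl {T (F x)}) (Σ-hom xs F))

  combination-hom : (xs : List A) (c : A → ℤ) (F : A → Fam) →
                    T (Σᶠ xs (λ x → c x · F x)) ≋ Σᶠ xs (λ x → c x · T (F x))
  combination-hom xs c F = ≋-trans (Σ-hom xs (λ x → c x · F x)) (Σᶠ-cong xs (λ x → ·-hom (c x) (F x)))

open Linear public

id-linear : Linear (λ F → F)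
id-linear = record { cong-≋ = λ F≋G → F≋G ; ⊕-hom = λ _ _ → ≋-refl ; ·-hom = λ _ _ → ≋-refl ; 0-hom = ≋-refl }

∘-linear : {T U : Fam → Fam} → Linear T → Linear U → Linear (T ∘ U)
∘-linear LT LU = record
  { cong-≋ = cong-≋ LT ∘ cong-≋ LU
  ; ⊕-hom  = λ F G → ≋-trans (cong-≋ LT (⊕-hom LU F G)) (⊕-hom LT _ _)
  ; ·-hom  = λ c F → ≋-trans (cong-≋ LT (·-hom LU c F)) (·-hom LT c _)
  ; 0-hom  = ≋-trans (cong-≋ LT (0-hom LU)) (0-hom LT)
  }

fold-linear : {T : Fam → Fam} → Linear T → (j : ℕ) → Linear (λ F → fold F T j)
fold-linear L zero    = id-linear
fold-linear L (suc j) = ∘-linear L (fold-linear L j)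

⊛ᶠ-linear : (G : Fam) → Linear (G ⊛ᶠ_)
⊛ᶠ-linear G = record
  { cong-≋ = λ F≋F′ → pos≈ λ n → ⊛-cong {f = G (suc n)} ≈ₚ-refl (at F≋F′ n)
  ; ⊕-hom  = λ F F′ → pos≈ λ n → ⊛-distribˡ-⊕ (G (suc n)) (F (suc n)) (F′ (suc n))
  ; ·-hom  = λ c F → pos≈ λ n → ⊛-scaleʳ c (G (suc n)) (F (suc n))
  ; 0-hom  = pos≈ λ n → ⊛-zeroʳ (G (suc n))
  }

⊛ᶠ-linearˡ : (G : Fam) → Linear (_⊛ᶠ G)
⊛ᶠ-linearˡ G = record
  { cong-≋ = λ F≋F′ → pos≈ λ n → ⊛-cong {g = G (suc n)} (at F≋F′ n) ≈ₚ-refl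
  ; ⊕-hom  = λ F F′ → pos≈ λ n → ⊛-distribʳ-⊕ (F (suc n)) (F′ (suc n)) (G (suc n))
  ; ·-hom  = λ c F → pos≈ λ n → ⊛-scaleˡ c (F (suc n)) (G (suc n))
  ; 0-hom  = pos≈ λ n → ⊛-zeroˡ (G (suc n))
  }

binomial-expansion : {T : Fam → Fam} → Linear T → (β : ℤ) (Y : ℕ → Fam) →
  (∀ i → T (Y i) ≋ β · Y i ⊕ᶠ Y (suc i)) →
  (j : ℕ) → fold (Y 0) T j ≋ Σᶠ (upTo (suc j)) (λ i → binom β j i · Y i)
binomial-expansion L β Y step zero    = pos≈ λ n N → sym (trans (ℤP.+-identityʳ _) (ℤP.*-identityˡ _))
binomial-expansion {T} L β Y step (suc j) = begin
  T (fold (Y 0) T j)                                ≈⟨ cong-≋ L (binomial-expansion L β Y step j) ⟩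
  T (Σᶠ I (λ i → binom β j i · Y i))                ≈⟨ combination-hom L I (binom β j) Y ⟩
  Σᶠ I (λ i → binom β j i · T (Y i))                ≈⟨ Σᶠ-cong I (λ i → ·-cong (binom β j i) (step i)) ⟩
  Σᶠ I (λ i → binom β j i · (β · Y i ⊕ᶠ Y (suc i)))  ≈⟨ pos≈ (λ n N → binom-pascal β j (λ i → Y i (suc n) N)) ⟩
  Σᶠ (upTo (suc (suc j))) (λ i → binom β (suc j) i · Y i) ∎
  where
  open SetoidReasoning ≋-setoid
  I : List ℕ
  I = upTo (suc j)

dagF : ℕ → Fam
dagF k n = dagFactor n (ent k)

szF : ℕ → Fam
szF k n = szFactor n k

dagF-1 : dagF 1 ≋ szF 1
dagF-1 = pos≈ λ n → ≈ₚ-sym (⊛-assoc (mono (suc n)) (geom (suc n)) 1ₚ)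

dagF-suc : (k : ℕ) → dagF (suc k) ≋ geom ⊛ᶠ dagF k
dagF-suc k = pos≈ λ n → ⊛-leftComm (mono (suc n)) (geom (suc n)) (geom (suc n) ^ₚ k)

dagF-as-fold : (j : ℕ) → dagF (suc j) ≋ fold (szF 1) (geom ⊛ᶠ_) j
dagF-as-fold zero    = dagF-1
dagF-as-fold (suc j) = ≋-trans (dagF-suc (suc j)) (cong-≋ (⊛ᶠ-linear geom) (dagF-as-fold j))

szF-as-fold : (j : ℕ) → szF (suc j) ≡ fold (szF 1) (geom⁺ ⊛ᶠ_) j
szF-as-fold zero    = refl
szF-as-fold (suc j) = cong (geom⁺ ⊛ᶠ_) (szF-as-fold j)

dagF-expansion : (j : ℕ) → dagF (suc j) ≋ Σᶠ (upTo (suc j)) (λ i → binom 1ℤ j i · szF (suc i))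
dagF-expansion j =
  ≋-trans (dagF-as-fold j) (binomial-expansion (⊛ᶠ-linear geom) 1ℤ (λ i → szF (suc i)) geom-step j)
  where
  geom-step : ∀ i → geom ⊛ᶠ szF (suc i) ≋ 1ℤ · szF (suc i) ⊕ᶠ szF (suc (suc i))
  geom-step i = pos≈ λ n N →
    trans (geom-⊛ n (szF (suc i) (suc n)) N)
          (cong (_+ szF (suc (suc i)) (suc n) N) (sym (ℤP.*-identityˡ (szF (suc i) (suc n) N))))

szF-expansion : (j : ℕ) → szF (suc j) ≋ Σᶠ (upTo (suc j)) (λ i → binom -1ℤ j i · dagF (suc i))
szF-expansion j = begin
  szF (suc j)                            ≡⟨ szF-as-fold j ⟩
  fold (szF 1) (geom⁺ ⊛ᶠ_) j             ≈⟨ cong-≋ (fold-linear (⊛ᶠ-linear geom⁺) j) (≋-sym dagF-1) ⟩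
  fold (dagF 1) (geom⁺ ⊛ᶠ_) j            ≈⟨ binomial-expansion (⊛ᶠ-linear geom⁺) -1ℤ (λ i → dagF (suc i)) geom⁺-step j ⟩
  Σᶠ (upTo (suc j)) (λ i → binom -1ℤ j i · dagF (suc i)) ∎
  where
  open SetoidReasoning ≋-setoid
  geom⁺-step : ∀ i → geom⁺ ⊛ᶠ dagF (suc i) ≋ -1ℤ · dagF (suc i) ⊕ᶠ dagF (suc (suc i))
  geom⁺-step i = pos≈ λ n N → trans (sym (-1ℤ*p+[p+q]≡q (dagF (suc i) (suc n) N) _))
    (cong (_+_ (-1ℤ * dagF (suc i) (suc n) N))
      (sym (trans (at (dagF-suc (suc i)) n N) (geom-⊛ n (dagF (suc i) (suc n)) N))))

-- Induction over the blocks (l_j, k_j): F-∷ expands the outermost block of F into outermost blocks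
-- of G, and G-∷ identifies those with linear maps applied to the remaining nested sum.
module Transfer
  (a : ℕ → ℕ → ℤ)
  (wt : ∀ {r} → Vec ℕ r → Vec ℕ r → ℤ)
  (wt-[] : wt [] [] ≡ + 1)
  (wt-∷ : ∀ {r} j i (ms ms′ : Vec ℕ r) → wt (suc j ∷ ms) (suc i ∷ ms′) ≡ a j i * wt ms ms′)
  (F G : ∀ {r} → Vec ℕ r → Vec ℕ r → Fam)
  (block : ℕ → ℕ → Fam → Fam)
  (block-linear : ∀ i i′ → Linear (block i i′))
  (F-[] : F [] [] ≋ G [] [])
  (F-∷ : ∀ {r} j k (ls ks : Vec ℕ r) → F (suc j ∷ ls) (suc k ∷ ks) ≋
           Σᶠ (upTo (suc j)) (λ i → a j i · Σᶠ (upTo (suc k)) (λ i′ → a k i′ · block i i′ (F ls ks))))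
  (G-∷ : ∀ {r} i i′ (ls ks : Vec ℕ r) → G (suc i ∷ ls) (suc i′ ∷ ks) ≋ block i i′ (G ls ks))
  where

  transfer : ∀ {r} (l k : Vec ℕ r) → Pos l → Pos k →
    F l k ≋ Σᶠ (box l) (λ l′ → Σᶠ (box k) (λ k′ → (wt l l′ * wt k k′) · G l′ k′))
  transfer [] [] [] [] = pos≈ λ n N → begin
    F [] [] (suc n) N                                   ≡⟨ at F-[] n N ⟩
    G [] [] (suc n) N                                   ≡⟨ unit (G [] [] (suc n) N) ⟩
    (+ 1 * + 1) * G [] [] (suc n) N + + 0 + + 0          ≡⟨ cong (λ w → (w * w) * G [] [] (suc n) N + + 0 + + 0) wt-[] ⟨
    (wt [] [] * wt [] []) * G [] [] (suc n) N + + 0 + + 0 ∎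
    where
    open ≡-Reasoning
    unit : ∀ g → g ≡ (+ 1 * + 1) * g + + 0 + + 0
    unit = solve-∀
  transfer (zero  ∷ ls) k            (() ∷ _)  _
  transfer (suc j ∷ ls) (zero  ∷ ks) _         (() ∷ _)
  transfer {suc r} (suc j ∷ ls) (suc k ∷ ks) (_ ∷ pls) (_ ∷ pks) = begin
    F (suc j ∷ ls) (suc k ∷ ks)
      ≈⟨ F-∷ j k ls ks ⟩
    Σᶠ I (λ i → a j i · Σᶠ K (λ i′ → a k i′ · block i i′ (F ls ks)))
      ≈⟨ Σᶠ-cong I (λ i → ·-cong (a j i) (Σᶠ-cong K (λ i′ → ·-cong (a k i′) (block-transfer i i′)))) ⟩
    Σᶠ I (λ i → a j i · Σᶠ K (λ i′ → a k i′ · Σᶠ (box ls) (λ x → Σᶠ (box ks) (λ y → c x y · G (suc i ∷ x) (suc i′ ∷ y)))))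
      ≈⟨ pos≈ (λ n N → Σℤ-interleave I K (box ls) (box ks) (a j) (a k) (wt ls) (wt ks) (λ i i′ x y → G (suc i ∷ x) (suc i′ ∷ y) (suc n) N)) ⟩
    Σᶠ I (λ i → Σᶠ (box ls) (λ x → Σᶠ K (λ i′ → Σᶠ (box ks) (λ y →
      (a j i * wt ls x * (a k i′ * wt ks y)) · G (suc i ∷ x) (suc i′ ∷ y)))))
      ≈⟨ Σᶠ-cong I (λ i → Σᶠ-cong (box ls) (λ x → Σᶠ-cong K (λ i′ → Σᶠ-cong (box ks) (λ y →
           ≋-reflexive (cong₂ (λ u v → (u * v) · G (suc i ∷ x) (suc i′ ∷ y)) (wt-∷ j i ls x) (wt-∷ k i′ ks y)))))) ⟨
    Σᶠ I (λ i → Σᶠ (box ls) (λ x → Σᶠ K (λ i′ → Σᶠ (box ks) (λ y →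
      (wt (suc j ∷ ls) (suc i ∷ x) * wt (suc k ∷ ks) (suc i′ ∷ y)) · G (suc i ∷ x) (suc i′ ∷ y)))))
      ≈⟨ Σᶠ-cong I (λ i → Σᶠ-cong (box ls) (λ x → Σᶠ-box-∷ (suc k) ks _)) ⟨
    Σᶠ I (λ i → Σᶠ (box ls) (λ x → Σᶠ (box (suc k ∷ ks)) (λ k′ →
      (wt (suc j ∷ ls) (suc i ∷ x) * wt (suc k ∷ ks) k′) · G (suc i ∷ x) k′)))
      ≈⟨ Σᶠ-box-∷ (suc j) ls _ ⟨
    Σᶠ (box (suc j ∷ ls)) (λ l′ → Σᶠ (box (suc k ∷ ks)) (λ k′ → (wt (suc j ∷ ls) l′ * wt (suc k ∷ ks) k′) · G l′ k′)) ∎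
    where
    open SetoidReasoning ≋-setoid
    I K : List ℕ
    I = upTo (suc j)
    K = upTo (suc k)
    c : Vec ℕ r → Vec ℕ r → ℤ
    c x y = wt ls x * wt ks y
    block-transfer : ∀ i i′ → block i i′ (F ls ks) ≋
      Σᶠ (box ls) (λ x → Σᶠ (box ks) (λ y → c x y · G (suc i ∷ x) (suc i′ ∷ y)))
    block-transfer i i′ = begin
      block i i′ (F ls ks)
        ≈⟨ cong-≋ L (transfer ls ks pls pks) ⟩
      block i i′ (Σᶠ (box ls) (λ x → Σᶠ (box ks) (λ y → c x y · G x y)))
        ≈⟨ Σ-hom L (box ls) _ ⟩
      Σᶠ (box ls) (λ x → block i i′ (Σᶠ (box ks) (λ y → c x y · G x y)))
        ≈⟨ Σᶠ-cong (box ls) (λ x → combination-hom L (box ks) (c x) (G x)) ⟩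
      Σᶠ (box ls) (λ x → Σᶠ (box ks) (λ y → c x y · block i i′ (G x y)))
        ≈⟨ Σᶠ-cong (box ls) (λ x → Σᶠ-cong (box ks) (λ y → ·-cong (c x y) (≋-sym (G-∷ i i′ x y)))) ⟩
      Σᶠ (box ls) (λ x → Σᶠ (box ks) (λ y → c x y · G (suc i ∷ x) (suc i′ ∷ y))) ∎
      where
      L : Linear (block i i′)
      L = block-linear i i′

-- Nested sums truncated at M

data Succession : Set where
  weak strict : Succession

next : Succession → ℕ → ℕ
next weak   n = n
next strict n = suc n

reindex-linear : (s : Succession) → Linear (_∘ next s)
reindex-linear s = record
  { cong-≋ = λ F≋G → pos≈ (at-next F≋G s)
  ; ⊕-hom  = λ _ _ → ≋-refl
  ; ·-hom  = λ _ _ → ≋-refl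
  ; 0-hom  = ≋-refl
  }
  where
  at-next : {F G : Fam} → F ≋ G → (s : Succession) (m : ℕ) → F (next s (suc m)) ≈ₚ G (next s (suc m))
  at-next F≋G weak   m = at F≋G m
  at-next F≋G strict m = at F≋G (suc m)

1ᶠ : Fam
1ᶠ n = 1ₚ

module Truncated (M : ℕ) where

  tailSum : Fam → Fam
  tailSum H lo = ΣL (range lo M) H

  tailSum-at : (H : Fam) (lo N : ℕ) → tailSum H lo N ≡ Σℤ (upTo (suc M ∸ lo)) (λ i → H (lo ℕ.+ i) N)
  tailSum-at H lo N = trans (ΣL-at (range lo M) H N) (Σℤ-map (lo ℕ.+_) (upTo (suc M ∸ lo)) (λ n → H n N))

  tailSum-linear : Linear tailSum
  tailSum-linear = record
    { cong-≋ = λ {H} {H′} H≋H′ → pos≈ λ n N → begin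
        tailSum H (suc n) N                         ≡⟨ tailSum-at H (suc n) N ⟩
        Σℤ (U n) (λ i → H (suc n ℕ.+ i) N)          ≡⟨ Σℤ-cong (U n) (λ i → at H≋H′ (n ℕ.+ i) N) ⟩
        Σℤ (U n) (λ i → H′ (suc n ℕ.+ i) N)         ≡⟨ tailSum-at H′ (suc n) N ⟨
        tailSum H′ (suc n) N                        ∎
    ; ⊕-hom  = λ H H′ → pos≈ λ n N → begin
        tailSum (H ⊕ᶠ H′) (suc n) N                 ≡⟨ tailSum-at (H ⊕ᶠ H′) (suc n) N ⟩
        Σℤ (U n) (λ i → H (suc n ℕ.+ i) N + H′ (suc n ℕ.+ i) N)
                                                    ≡⟨ Σℤ-distrib-+ (U n) (λ i → H (suc n ℕ.+ i) N) (λ i → H′ (suc n ℕ.+ i) N) ⟩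
        Σℤ (U n) (λ i → H (suc n ℕ.+ i) N) + Σℤ (U n) (λ i → H′ (suc n ℕ.+ i) N)
                                                    ≡⟨ cong₂ _+_ (tailSum-at H (suc n) N) (tailSum-at H′ (suc n) N) ⟨
        tailSum H (suc n) N + tailSum H′ (suc n) N  ∎
    ; ·-hom  = λ c H → pos≈ λ n N → begin
        tailSum (c · H) (suc n) N                   ≡⟨ tailSum-at (c · H) (suc n) N ⟩
        Σℤ (U n) (λ i → c * H (suc n ℕ.+ i) N)      ≡⟨ *-distribˡ-Σℤ c (U n) (λ i → H (suc n ℕ.+ i) N) ⟨
        c * Σℤ (U n) (λ i → H (suc n ℕ.+ i) N)      ≡⟨ cong (c *_) (tailSum-at H (suc n) N) ⟨
        c * tailSum H (suc n) N                     ∎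
    ; 0-hom  = pos≈ λ n N → trans (tailSum-at 0ᶠ (suc n) N) (Σℤ-zero (U n))
    }
    where
    open ≡-Reasoning
    U : ℕ → List ℕ
    U n = upTo (suc M ∸ suc n)

  Vanishing : Fam → Set
  Vanishing G = ∀ n → M < n → G n ≈ₚ 0ₚ

  tailSum-vanishing : (H : Fam) → Vanishing (tailSum H)
  tailSum-vanishing H n M<n N =
    trans (tailSum-at H n N) (cong (λ u → Σℤ (upTo u) (λ i → H (n ℕ.+ i) N)) (ℕP.m≤n⇒m∸n≡0 M<n))

  prepend : Fam → Succession → Fam → Fam
  prepend φ s R = tailSum (φ ⊛ᶠ (R ∘ next s))

  prepend-linear : (φ : Fam) (s : Succession) → Linear (prepend φ s)
  prepend-linear φ s = ∘-linear tailSum-linear (∘-linear (⊛ᶠ-linear φ) (reindex-linear s))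

  prepend-linearˡ : (s : Succession) (R : Fam) → Linear (λ φ → prepend φ s R)
  prepend-linearˡ s R = ∘-linear tailSum-linear (⊛ᶠ-linearˡ (R ∘ next s))

  prepend-bar prepend-zero : Fam → Fam
  prepend-bar  = prepend 1ᶠ weak
  prepend-zero = prepend 1ᶠ strict

  prepend-bar-split : (G : Fam) → Vanishing G → prepend-bar G ≋ G ⊕ᶠ prepend-zero G
  prepend-bar-split G G-vanishing = pos≈ split-at
    where
    split-at : ∀ n → prepend-bar G (suc n) ≈ₚ G (suc n) ⊕ prepend-zero G (suc n)
    split-at n N = begin
      prepend-bar G (suc n) N                          ≡⟨ tailSum-at (1ᶠ ⊛ᶠ G) (suc n) N ⟩
      Σℤ U (λ i → (1ₚ ⊛ G (suc n ℕ.+ i)) N)            ≡⟨ Σℤ-cong U (λ i → ⊛-identityˡ (G (suc n ℕ.+ i)) N) ⟩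
      Σℤ U (λ i → G (suc n ℕ.+ i) N)                   ≡⟨ Σℤ-upTo-shift (M ∸ n) (λ i → G (suc n ℕ.+ i) N) top-vanishes ⟩
      G (suc n ℕ.+ 0) N + Σℤ U (λ i → G (suc n ℕ.+ suc i) N)
                                                       ≡⟨ cong₂ _+_ (cong (λ m → G m N) (ℕP.+-identityʳ (suc n)))
                                                                    (Σℤ-cong U λ i → cong (λ m → G m N) (ℕP.+-suc (suc n) i)) ⟩
      G (suc n) N + Σℤ U (λ i → G (suc (suc n ℕ.+ i)) N)
                                                       ≡⟨ cong (_+_ (G (suc n) N)) (Σℤ-cong U λ i → ⊛-identityˡ (G (suc (suc n ℕ.+ i))) N) ⟨
      G (suc n) N + Σℤ U (λ i → (1ₚ ⊛ G (suc (suc n ℕ.+ i))) N)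
                                                       ≡⟨ cong (_+_ (G (suc n) N)) (tailSum-at (1ᶠ ⊛ᶠ (G ∘ suc)) (suc n) N) ⟨
      G (suc n) N + prepend-zero G (suc n) N           ∎
      where
      open ≡-Reasoning
      U : List ℕ
      U = upTo (M ∸ n)
      top-vanishes : G (suc n ℕ.+ (M ∸ n)) N ≡ + 0
      top-vanishes = G-vanishing (suc n ℕ.+ (M ∸ n)) (s≤s (ℕP.m≤n+m∸n M n)) N

  block-expansion : {T U : Fam → Fam} → Linear T → Linear U → (β : ℤ) →
    (∀ G → Vanishing G → T G ≋ β · G ⊕ᶠ U G) → (∀ G → Vanishing (U G)) →
    {φ ψ : ℕ → Fam} → (∀ k → φ (suc k) ≋ Σᶠ (upTo (suc k)) (λ i → binom β k i · ψ (suc i))) →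
    (j k : ℕ) (W : Fam) →
    fold (prepend (φ (suc k)) strict W) T j ≋
      Σᶠ (upTo (suc j)) (λ i → binom β j i ·
        Σᶠ (upTo (suc k)) (λ i′ → binom β k i′ · fold (prepend (ψ (suc i′)) strict W) U i))
  block-expansion {T} {U} LT LU β T-split U-vanishing {φ} {ψ} φ-expansion j k W = begin
    fold (Y 0) T j                                  ≈⟨ binomial-expansion LT β Y (λ i → T-split (Y i) (Y-vanishing i)) j ⟩
    Σᶠ (upTo (suc j)) (λ i → binom β j i · Y i)     ≈⟨ Σᶠ-cong (upTo (suc j)) (λ i → ·-cong (binom β j i) (Y-expansion i)) ⟩
    Σᶠ (upTo (suc j)) (λ i → binom β j i · Σᶠ K (λ i′ → binom β k i′ · fold (prepend (ψ (suc i′)) strict W) U i)) ∎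
    where
    open SetoidReasoning ≋-setoid
    K : List ℕ
    K = upTo (suc k)
    Y : ℕ → Fam
    Y = fold (prepend (φ (suc k)) strict W) U
    Y-vanishing : ∀ i → Vanishing (Y i)
    Y-vanishing zero    = tailSum-vanishing (φ (suc k) ⊛ᶠ (W ∘ suc))
    Y-vanishing (suc i) = U-vanishing (Y i)
    Y-expansion : ∀ i → Y i ≋ Σᶠ K (λ i′ → binom β k i′ · fold (prepend (ψ (suc i′)) strict W) U i)
    Y-expansion i = begin
      fold (prepend (φ (suc k)) strict W) U i
        ≈⟨ cong-≋ Uⁱ (cong-≋ (prepend-linearˡ strict W) (φ-expansion k)) ⟩
      fold (prepend (Σᶠ K (λ i′ → binom β k i′ · ψ (suc i′))) strict W) U i
        ≈⟨ cong-≋ Uⁱ (combination-hom (prepend-linearˡ strict W) K (binom β k) (ψ ∘ suc)) ⟩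
      fold (Σᶠ K (λ i′ → binom β k i′ · prepend (ψ (suc i′)) strict W)) U i
        ≈⟨ combination-hom Uⁱ K (binom β k) (λ i′ → prepend (ψ (suc i′)) strict W) ⟩
      Σᶠ K (λ i′ → binom β k i′ · fold (prepend (ψ (suc i′)) strict W) U i) ∎
      where
      Uⁱ : Linear (λ F → fold F U i)
      Uⁱ = fold-linear LU i

  dag : List DEnt → Fam
  dag es lo = dagSum es lo M

  sz : List ℕ → Fam
  sz ks lo = szSum ks lo M

  dagBlock szBlock : ℕ → ℕ → Fam → Fam
  dagBlock j k W = fold (prepend (dagF (suc k)) strict W) prepend-bar j
  szBlock  j k W = fold (prepend (szF (suc k)) strict W) prepend-zero j

  dag-bars : (j : ℕ) (es : List DEnt) → dag (replicate j bar ++ es) ≡ fold (dag es) prepend-bar j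
  dag-bars zero    es = refl
  dag-bars (suc j) es = cong prepend-bar (dag-bars j es)

  sz-zeros : (j : ℕ) (ks : List ℕ) → sz (replicate j 0 ++ ks) ≡ fold (sz ks) prepend-zero j
  sz-zeros zero    ks = refl
  sz-zeros (suc j) ks = cong prepend-zero (sz-zeros j ks)

  dagBlock-linear : (i i′ : ℕ) → Linear (dagBlock i i′)
  dagBlock-linear i i′ = ∘-linear (fold-linear (prepend-linear 1ᶠ weak) i) (prepend-linear (dagF (suc i′)) strict)

  szBlock-linear : (i i′ : ℕ) → Linear (szBlock i i′)
  szBlock-linear i i′ = ∘-linear (fold-linear (prepend-linear 1ᶠ strict) i) (prepend-linear (szF (suc i′)) strict)

  dagBlock-expansion : (j k : ℕ) (W : Fam) →
    dagBlock j k W ≋ Σᶠ (upTo (suc j)) (λ i → binom 1ℤ j i · Σᶠ (upTo (suc k)) (λ i′ → binom 1ℤ k i′ · szBlock i i′ W))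
  dagBlock-expansion = block-expansion (prepend-linear 1ᶠ weak) (prepend-linear 1ᶠ strict) 1ℤ bar-split
                                       (λ G → tailSum-vanishing (1ᶠ ⊛ᶠ (G ∘ suc))) {dagF} {szF} dagF-expansion
    where
    bar-split : ∀ G → Vanishing G → prepend-bar G ≋ 1ℤ · G ⊕ᶠ prepend-zero G
    bar-split G G-vanishing = ≋-trans (prepend-bar-split G G-vanishing)
                                      (⊕ᶠ-cong {G} {1ℤ · G} (pos≈ λ n N → sym (ℤP.*-identityˡ (G (suc n) N))) ≋-refl)

  szBlock-expansion : (j k : ℕ) (W : Fam) →
    szBlock j k W ≋ Σᶠ (upTo (suc j)) (λ i → binom -1ℤ j i · Σᶠ (upTo (suc k)) (λ i′ → binom -1ℤ k i′ · dagBlock i i′ W))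
  szBlock-expansion = block-expansion (prepend-linear 1ᶠ strict) (prepend-linear 1ᶠ weak) -1ℤ zero-split
                                      (λ G → tailSum-vanishing (1ᶠ ⊛ᶠ G)) {szF} {dagF} szF-expansion
    where
    zero-split : ∀ G → Vanishing G → prepend-zero G ≋ -1ℤ · G ⊕ᶠ prepend-bar G
    zero-split G G-vanishing = pos≈ λ n N → trans (sym (-1ℤ*p+[p+q]≡q (G (suc n) N) _))
      (cong (_+_ (-1ℤ * G (suc n) N)) (sym (at (prepend-bar-split G G-vanishing) n N)))

  sz-as-dag : {r : ℕ} (l k : Vec ℕ r) → Pos l → Pos k →
    sz (szIdx l k) ≋ Σᶠ (box l) (λ l′ → Σᶠ (box k) (λ k′ → (bb l l′ * bb k k′) · dag (dagIdx l′ k′)))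
  sz-as-dag = Transfer.transfer (binom -1ℤ) bb refl (λ j i ms ms′ → cong (_* bb ms ms′) (sym (binom-[-1ℤ] j i)))
    (λ l k → sz (szIdx l k)) (λ l k → dag (dagIdx l k)) dagBlock dagBlock-linear ≋-refl
    (λ j k ls ks → ≋-trans (≋-reflexive (sz-zeros j (suc k ∷ szIdx ls ks))) (szBlock-expansion j k (sz (szIdx ls ks))))
    (λ i i′ ls ks → ≋-reflexive (dag-bars i (ent (suc i′) ∷ dagIdx ls ks)))

  dag-as-sz : {r : ℕ} (l k : Vec ℕ r) → Pos l → Pos k →
    dag (dagIdx l k) ≋ Σᶠ (box l) (λ l′ → Σᶠ (box k) (λ k′ → (b l l′ * b k k′) · sz (szIdx l′ k′)))
  dag-as-sz = Transfer.transfer (binom 1ℤ) b refl (λ j i ms ms′ → cong (_* b ms ms′) (sym (binom-[1ℤ] j i)))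
    (λ l k → dag (dagIdx l k)) (λ l k → sz (szIdx l k)) szBlock szBlock-linear ≋-refl
    (λ j k ls ks → ≋-trans (≋-reflexive (dag-bars j (ent (suc k) ∷ dagIdx ls ks))) (dagBlock-expansion j k (dag (dagIdx ls ks))))
    (λ i i′ ls ks → ≋-reflexive (sz-zeros i (suc i′ ∷ szIdx ls ks)))

ζSZ-as-ζDag : {r : ℕ} (l k : Vec ℕ r) → Pos l → Pos k →
  ζSZ (szIdx l k) ≈ₚ ΣL (box l) (λ l′ → ΣL (box k) (λ k′ → scale (bb l l′ * bb k k′) (ζDag (dagIdx l′ k′))))
ζSZ-as-ζDag l k pl pk N = trans (at (Truncated.sz-as-dag N l k pl pk) 0 N)
  (sym (ΣL²-at (box l) (box k) (λ l′ k′ → bb l l′ * bb k k′) (λ l′ k′ → ζDag (dagIdx l′ k′)) N))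

ζDag-as-ζSZ : {r : ℕ} (l k : Vec ℕ r) → Pos l → Pos k →
  ζDag (dagIdx l k) ≈ₚ ΣL (box l) (λ l′ → ΣL (box k) (λ k′ → scale (b l l′ * b k k′) (ζSZ (szIdx l′ k′))))
ζDag-as-ζSZ l k pl pk N = trans (at (Truncated.dag-as-sz N l k pl pk) 0 N)
  (sym (ΣL²-at (box l) (box k) (λ l′ k′ → b l l′ * b k k′) (λ l′ k′ → ζSZ (szIdx l′ k′)) N))

ones : (r : ℕ) → Vec ℕ r
ones r = Vec.replicate r 1

ones-pos : (r : ℕ) → Pos (ones r)
ones-pos zero    = []
ones-pos (suc r) = s≤s z≤n ∷ ones-pos r

box-ones : (r : ℕ) → box (ones r) ≡ ones r ∷ []
box-ones zero    = refl
box-ones (suc r) rewrite box-ones r = refl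

b-ones : (r : ℕ) → b (ones r) (ones r) ≡ + 1
b-ones zero    = refl
b-ones (suc r) = cong (+ 1 *_) (b-ones r)

bb-ones : (r : ℕ) → bb (ones r) (ones r) ≡ + 1
bb-ones zero    = refl
bb-ones (suc r) = cong (+ 1 *_) (bb-ones r)

szIdx-ones : {r : ℕ} (k : Vec ℕ r) → szIdx (ones r) k ≡ toList k
szIdx-ones []      = refl
szIdx-ones (x ∷ k) = cong (x ∷_) (szIdx-ones k)

dagIdx-ones : {r : ℕ} (k : Vec ℕ r) → dagIdx (ones r) k ≡ dagVec k
dagIdx-ones []      = refl
dagIdx-ones (x ∷ k) = cong (ent x ∷_) (dagIdx-ones k)

ΣL-box-ones : {r : ℕ} (wt : Vec ℕ r → Vec ℕ r → ℤ) → wt (ones r) (ones r) ≡ + 1 →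
  (k : Vec ℕ r) (Z : Vec ℕ r → Vec ℕ r → PS) (Z₁ : Vec ℕ r → PS) → (∀ k′ → Z (ones r) k′ ≈ₚ Z₁ k′) →
  ΣL (box (ones r)) (λ l′ → ΣL (box k) (λ k′ → scale (wt (ones r) l′ * wt k k′) (Z l′ k′)))
    ≈ₚ ΣL (box k) (λ k′ → scale (wt k k′) (Z₁ k′))
ΣL-box-ones {r} wt wt-ones k Z Z₁ Z≈Z₁ N rewrite box-ones r = begin
  ΣL (box k) (λ k′ → scale (wt (ones r) (ones r) * wt k k′) (Z (ones r) k′)) N + + 0
    ≡⟨ ℤP.+-identityʳ _ ⟩
  ΣL (box k) (λ k′ → scale (wt (ones r) (ones r) * wt k k′) (Z (ones r) k′)) N
    ≡⟨ ΣL-at (box k) (λ k′ → scale (wt (ones r) (ones r) * wt k k′) (Z (ones r) k′)) N ⟩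
  Σℤ (box k) (λ k′ → (wt (ones r) (ones r) * wt k k′) * Z (ones r) k′ N)
    ≡⟨ Σℤ-cong (box k) (λ k′ → cong₂ _*_ (trans (cong (_* wt k k′) wt-ones) (ℤP.*-identityˡ (wt k k′))) (Z≈Z₁ k′ N)) ⟩
  Σℤ (box k) (λ k′ → wt k k′ * Z₁ k′ N)
    ≡⟨ ΣL-at (box k) (λ k′ → scale (wt k k′) (Z₁ k′)) N ⟨
  ΣL (box k) (λ k′ → scale (wt k k′) (Z₁ k′)) N ∎
  where open ≡-Reasoning

ζSZ-vec-as-ζDag : {r : ℕ} (k : Vec ℕ r) → Pos k →
  ζSZ (toList k) ≈ₚ ΣL (box k) (λ k′ → scale (bb k k′) (ζDag (dagVec k′)))
ζSZ-vec-as-ζDag {r} k pk N = begin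
  ζSZ (toList k) N                    ≡⟨ cong (λ ks → ζSZ ks N) (szIdx-ones k) ⟨
  ζSZ (szIdx (ones r) k) N            ≡⟨ ζSZ-as-ζDag (ones r) k (ones-pos r) pk N ⟩
  ΣL (box (ones r)) (λ l′ → ΣL (box k) (λ k′ → scale (bb (ones r) l′ * bb k k′) (ζDag (dagIdx l′ k′)))) N
                                      ≡⟨ ΣL-box-ones bb (bb-ones r) k (λ l′ k′ → ζDag (dagIdx l′ k′)) (ζDag ∘ dagVec)
                                                     (λ k′ N → cong (λ es → ζDag es N) (dagIdx-ones k′)) N ⟩
  ΣL (box k) (λ k′ → scale (bb k k′) (ζDag (dagVec k′))) N ∎
  where open ≡-Reasoning

ζDag-vec-as-ζSZ : {r : ℕ} (k : Vec ℕ r) → Pos k →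
  ζDag (dagVec k) ≈ₚ ΣL (box k) (λ k′ → scale (b k k′) (ζSZ (toList k′)))
ζDag-vec-as-ζSZ {r} k pk N = begin
  ζDag (dagVec k) N                   ≡⟨ cong (λ es → ζDag es N) (dagIdx-ones k) ⟨
  ζDag (dagIdx (ones r) k) N          ≡⟨ ζDag-as-ζSZ (ones r) k (ones-pos r) pk N ⟩
  ΣL (box (ones r)) (λ l′ → ΣL (box k) (λ k′ → scale (b (ones r) l′ * b k k′) (ζSZ (szIdx l′ k′)))) N
                                      ≡⟨ ΣL-box-ones b (b-ones r) k (λ l′ k′ → ζSZ (szIdx l′ k′)) (ζSZ ∘ toList)
                                                     (λ k′ N → cong (λ ks → ζSZ ks N) (szIdx-ones k′)) N ⟩
  ΣL (box k) (λ k′ → scale (b k k′) (ζSZ (toList k′))) N ∎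
  where open ≡-Reasoning

lemma2p3 : (r : ℕ) (l k : Vec ℕ r) → Pos l → Pos k →
    (ζSZ (szIdx l k) ≈ₚ ΣL (box l) (λ l' → ΣL (box k) (λ k' → scale (bb l l' * bb k k') (ζDag (dagIdx l' k')))))
    × (ζSZ (toList k) ≈ₚ ΣL (box k) (λ k' → scale (bb k k') (ζDag (dagVec k'))))
    × (ζDag (dagIdx l k) ≈ₚ ΣL (box l) (λ l' → ΣL (box k) (λ k' → scale (b l l' * b k k') (ζSZ (szIdx l' k')))))
    × (ζDag (dagVec k) ≈ₚ ΣL (box k) (λ k' → scale (b k k') (ζSZ (toList k'))))
lemma2p3 r l k pl pk =
  ζSZ-as-ζDag l k pl pk , ζSZ-vec-as-ζDag k pk , ζDag-as-ζSZ l k pl pk , ζDag-vec-as-ζSZ k pk
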